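{- Let $r/s>1$ be a rational number ($r,s$ coprime positive integers) and $\left[\frac rs\right]_q=\frac{\mathcal R(q)}{\mathcal S(q)}$. Then: (i) $\mathcal R(-1)$ and $\mathcal S(-1)$ each belong to $\{ -1,0,1\}$; (ii) $\mathcal R(-1)=0$ if and only if $r$ is even; (iii) $\mathcal S(-1)=0$ if and only if $s$ is even.
   Context: $q$ is a formal variable and $[a]_q=1+q+\cdots+q^{a-1}$ for a positive integer $a$. Every rational $r/s>1$ has a unique negative continued fraction expansion $r/s=\llbracket c_1,\ldots,c_k\rrbracket=c_1-\cfrac{1}{c_2-\cfrac{1}{\ddots-\cfrac{1}{c_k}}}$ with integers $c_i\ge 2$. Its $q$-deformation is the rational function $$\left[\tfrac{r}{s}\right]_q:=[c_1]_q-\cfrac{q^{c_1-1}}{[c_2]_q-\cfrac{q^{c_2-1}}{\ddots-\cfrac{q^{c_{k-1}-1}}{[c_k]_q}}},$$ written as $\frac{\mathcal R(q)}{\mathcal S(q)}$ with $\mathcal R,\mathcal S\in\mathbb Z[q]$ coprime and normalized by $\mathcal R(1)=r$, $\mathcal S(1)=s$. -}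

module Defs where

open import Data.Nat as ℕ using (ℕ; zero; suc)
open import Data.Integer as ℤ using (ℤ; +_; -_; 0ℤ; 1ℤ)
open import Data.List using (List; []; _∷_; replicate; _++_)
open import Data.Product using (_×_; _,_; ∃)
open import Relation.Binary.PropositionalEquality using (_≡_)

-- Polynomials in ℤ[q] as coefficient lists, lowest degree first.
-- Trailing zeros are allowed; equality is coefficientwise (≈P).
Poly : Set
Poly = List ℤ

coeff : Poly → ℕ → ℤ
coeff []       _       = 0ℤ
coeff (a ∷ p)  zero    = a
coeff (a ∷ p)  (suc i) = coeff p i

infix 4 _≈P_
_≈P_ : Poly → Poly → Set
p ≈P p' = ∀ i → coeff p i ≡ coeff p' i

infixl 6 _+P_ _-P_
infixl 7 _*P_ _·P_

_+P_ : Poly → Poly → Poly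
[]      +P p'       = p'
(a ∷ p) +P []       = a ∷ p
(a ∷ p) +P (b ∷ p') = (a ℤ.+ b) ∷ (p +P p')

_·P_ : ℤ → Poly → Poly
c ·P []      = []
c ·P (a ∷ p) = (c ℤ.* a) ∷ (c ·P p)

negP : Poly → Poly
negP p = (- 1ℤ) ·P p

_-P_ : Poly → Poly → Poly
p -P p' = p +P negP p'

_*P_ : Poly → Poly → Poly
[]      *P p' = []
(a ∷ p) *P p' = (a ·P p') +P (0ℤ ∷ (p *P p'))

oneP : Poly
oneP = 1ℤ ∷ []

infix 4 _∣P_
_∣P_ : Poly → Poly → Set
d ∣P p = ∃ λ e → d *P e ≈P p

CoprimeP : Poly → Poly → Set
CoprimeP p p' = ∀ d → d ∣P p → d ∣P p' → d ∣P oneP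

evalP : Poly → ℤ → ℤ
evalP []      x = 0ℤ
evalP (a ∷ p) x = a ℤ.+ x ℤ.* evalP p x

qInt : ℕ → Poly
qInt a = replicate a 1ℤ

qPow : ℕ → Poly
qPow k = replicate k 0ℤ ++ (1ℤ ∷ [])

-- Negative continued fraction ⟦c₁,…,c_k⟧ (list given as head c₁ and tail),
-- evaluated as a pair (numerator , denominator) of integers:
-- ⟦c⟧ = c/1 ;  ⟦c, rest⟧ = c - 1/⟦rest⟧ = (c·n - d)/n  where ⟦rest⟧ = n/d.
ncf : ℕ → List ℕ → ℤ × ℤ
ncf c []        = (+ c , 1ℤ)
ncf c (c' ∷ cs) with ncf c' cs
... | (n , d) = ((+ c) ℤ.* n ℤ.- d , n)

-- q-deformed negative continued fraction, as a pair (numerator , denominator)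
-- of polynomials:  [c]_q / 1 ;  [c]_q - q^(c-1) / (N/D) = ([c]_q N - q^(c-1) D) / N.
qncf : ℕ → List ℕ → Poly × Poly
qncf c []        = (qInt c , oneP)
qncf c (c' ∷ cs) with qncf c' cs
... | (N , D) = (qInt c *P N -P qPow (c ℕ.∸ 1) *P D , N)

-- Write [c₁,…,c_k]_q = N/D with (N, D) built by the recursion (N, D) ↦ ([c]_q N − q^(c−1) D, N).
-- Each step has determinant q^(c−1), so some power q^m lies in the ideal (N, D); as N(0) = 1, q is
-- prime to N, and R D = S N then gives R = N T and S = D T. Since R and S are coprime, T divides 1,
-- so T(−1) = ±1. At q = −1 every step permutes the six vectors ±(1,0), ±(0,1), ±(1,1), so N(−1),
-- D(−1), and hence R(−1), S(−1), lie in {−1, 0, 1}. Finally p(1) ≡ p(−1) mod 2 for p ∈ ℤ[q], so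
-- R(−1) = 0 exactly when r = R(1) is even, and likewise for S.
module Submission where

open import Defs
open import Data.Nat as ℕ using (ℕ; _≤_; _<_)
open import Data.Nat.Coprimality using (Coprime)
open import Data.Nat.Divisibility using (_∣_)
open import Data.Integer as ℤ using (ℤ; +_; -_; 0ℤ; 1ℤ)
open import Data.List using (List; _∷_)
open import Data.List.Relation.Unary.All using (All)
open import Data.Product using (_×_; _,_; proj₁; proj₂)
open import Data.Sum using (_⊎_)
open import Function.Bundles using (_⇔_)
open import Relation.Binary.PropositionalEquality using (_≡_)

open import Algebra.Bundles using (AbelianGroup; CommutativeRing)
open import Algebra.Solver.Ring.AlmostCommutativeRing using (_-Raw-AlmostCommutative⟶_; fromCommutativeRing)
open import Algebra.Structures using (IsAbelianGroup)
open import Data.Integer using (_+_; _*_; _-_; ∣_∣; -[1+_])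
import Data.Integer.Properties as ℤ
open import Data.Integer.Tactic.RingSolver using (solve-∀)
open import Data.List using ([])
import Data.List.Relation.Unary.All as All
open import Data.List.Relation.Unary.All using (_∷_)
open import Data.Maybe using (Maybe; just; nothing)
open import Data.Nat using (zero; suc; s≤s)
open import Data.Nat.Divisibility using (divides)
import Data.Nat.Properties as ℕ
open import Data.Product using (Σ)
open import Data.Sum using (inj₁; inj₂)
open import Function.Bundles using (mk⇔)
open import Relation.Binary.Bundles using (Setoid)
open import Relation.Binary.PropositionalEquality
  using (_≢_; refl; sym; trans; cong; cong₂; subst; module ≡-Reasoning)
import Relation.Binary.Reasoning.Setoid
open import Relation.Binary.Structures using (IsEquivalence)
open import Relation.Nullary using (yes; no; contradiction)

-- The ring ℤ[q]

-- _≈P_ wrapped in a record, so that both polynomials can be inferred from a proof of it.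
infix 4 _≋_
record _≋_ (p p' : Poly) : Set where
  constructor mk≋
  field coeff-≡ : p ≈P p'
open _≋_

≋-isEquivalence : IsEquivalence _≋_
≋-isEquivalence = record
  { refl  = mk≋ λ _ → refl
  ; sym   = λ (mk≋ e) → mk≋ λ i → sym (e i)
  ; trans = λ (mk≋ e) (mk≋ f) → mk≋ λ i → trans (e i) (f i)
  }

≋-setoid : Setoid _ _
≋-setoid = record { isEquivalence = ≋-isEquivalence }

open IsEquivalence ≋-isEquivalence
  using () renaming (refl to ≋-refl; sym to ≋-sym; trans to ≋-trans)

module ≋-Reasoning = Relation.Binary.Reasoning.Setoid ≋-setoid

∷-cong : ∀ {a b p p'} → a ≡ b → p ≋ p' → a ∷ p ≋ b ∷ p'
∷-cong refl (mk≋ e) = mk≋ λ { zero → refl ; (suc i) → e i }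

0∷[]≋[] : 0ℤ ∷ [] ≋ []
0∷[]≋[] = mk≋ λ { zero → refl ; (suc i) → refl }

coeff-+P : ∀ p q i → coeff (p +P q) i ≡ coeff p i + coeff q i
coeff-+P []      q       i       = sym (ℤ.+-identityˡ _)
coeff-+P (a ∷ p) []      i       = sym (ℤ.+-identityʳ _)
coeff-+P (a ∷ p) (b ∷ q) zero    = refl
coeff-+P (a ∷ p) (b ∷ q) (suc i) = coeff-+P p q i

coeff-·P : ∀ c p i → coeff (c ·P p) i ≡ c * coeff p i
coeff-·P c []      i       = sym (ℤ.*-zeroʳ c)
coeff-·P c (a ∷ p) zero    = refl
coeff-·P c (a ∷ p) (suc i) = coeff-·P c p i

+P-cong : ∀ {p p' q q'} → p ≋ p' → q ≋ q' → p +P q ≋ p' +P q'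
+P-cong {p} {p'} {q} {q'} (mk≋ e) (mk≋ f) = mk≋ λ i → begin
  coeff (p +P q) i          ≡⟨ coeff-+P p q i ⟩
  coeff p i + coeff q i     ≡⟨ cong₂ _+_ (e i) (f i) ⟩
  coeff p' i + coeff q' i   ≡⟨ coeff-+P p' q' i ⟨
  coeff (p' +P q') i        ∎
  where open ≡-Reasoning

+P-assoc : ∀ p q r → (p +P q) +P r ≋ p +P (q +P r)
+P-assoc p q r = mk≋ λ i → begin
  coeff ((p +P q) +P r) i              ≡⟨ coeff-+P (p +P q) r i ⟩
  coeff (p +P q) i + coeff r i         ≡⟨ cong (_+ coeff r i) (coeff-+P p q i) ⟩
  coeff p i + coeff q i + coeff r i    ≡⟨ ℤ.+-assoc (coeff p i) _ _ ⟩
  coeff p i + (coeff q i + coeff r i)  ≡⟨ cong (_+_ (coeff p i)) (coeff-+P q r i) ⟨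
  coeff p i + coeff (q +P r) i         ≡⟨ coeff-+P p (q +P r) i ⟨
  coeff (p +P (q +P r)) i              ∎
  where open ≡-Reasoning

+P-comm : ∀ p q → p +P q ≋ q +P p
+P-comm p q = mk≋ λ i → begin
  coeff (p +P q) i       ≡⟨ coeff-+P p q i ⟩
  coeff p i + coeff q i  ≡⟨ ℤ.+-comm (coeff p i) _ ⟩
  coeff q i + coeff p i  ≡⟨ coeff-+P q p i ⟨
  coeff (q +P p) i       ∎
  where open ≡-Reasoning

+P-identityˡ : ∀ p → [] +P p ≋ p
+P-identityˡ p = ≋-refl

+P-identityʳ : ∀ p → p +P [] ≋ p
+P-identityʳ []      = ≋-refl
+P-identityʳ (a ∷ p) = ≋-refl

·P-congʳ : ∀ c {p p'} → p ≋ p' → c ·P p ≋ c ·P p'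
·P-congʳ c {p} {p'} (mk≋ e) = mk≋ λ i → begin
  coeff (c ·P p) i   ≡⟨ coeff-·P c p i ⟩
  c * coeff p i      ≡⟨ cong (c *_) (e i) ⟩
  c * coeff p' i     ≡⟨ coeff-·P c p' i ⟨
  coeff (c ·P p') i  ∎
  where open ≡-Reasoning

negP-inverseˡ : ∀ p → negP p +P p ≋ []
negP-inverseˡ p = mk≋ λ i → begin
  coeff (negP p +P p) i                ≡⟨ coeff-+P (negP p) p i ⟩
  coeff (negP p) i + coeff p i         ≡⟨ cong (_+ coeff p i) (coeff-·P (- 1ℤ) p i) ⟩
  - 1ℤ * coeff p i + coeff p i         ≡⟨ cong (_+ coeff p i) (ℤ.-1*i≡-i (coeff p i)) ⟩
  - coeff p i + coeff p i              ≡⟨ ℤ.+-inverseˡ (coeff p i) ⟩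
  0ℤ                                   ∎
  where open ≡-Reasoning

negP-inverseʳ : ∀ p → p +P negP p ≋ []
negP-inverseʳ p = ≋-trans (+P-comm p (negP p)) (negP-inverseˡ p)

+P-isAbelianGroup : IsAbelianGroup _≋_ _+P_ [] negP
+P-isAbelianGroup = record
  { isGroup = record
    { isMonoid = record
      { isSemigroup = record
        { isMagma = record { isEquivalence = ≋-isEquivalence ; ∙-cong = +P-cong }
        ; assoc   = +P-assoc
        }
      ; identity = +P-identityˡ , +P-identityʳ
      }
    ; inverse = negP-inverseˡ , negP-inverseʳ
    ; ⁻¹-cong = ·P-congʳ (- 1ℤ)
    }
  ; comm = +P-comm
  }

+P-abelianGroup : AbelianGroup _ _
+P-abelianGroup = record { isAbelianGroup = +P-isAbelianGroup }

open import Algebra.Properties.CommutativeSemigroup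
  (AbelianGroup.commutativeSemigroup +P-abelianGroup)
  using (interchange; x∙yz≈y∙xz)

·P-distribˡ : ∀ c p q → c ·P (p +P q) ≋ c ·P p +P c ·P q
·P-distribˡ c p q = mk≋ λ i → begin
  coeff (c ·P (p +P q)) i                ≡⟨ coeff-·P c (p +P q) i ⟩
  c * coeff (p +P q) i                   ≡⟨ cong (c *_) (coeff-+P p q i) ⟩
  c * (coeff p i + coeff q i)            ≡⟨ ℤ.*-distribˡ-+ c (coeff p i) _ ⟩
  c * coeff p i + c * coeff q i          ≡⟨ cong₂ _+_ (coeff-·P c p i) (coeff-·P c q i) ⟨
  coeff (c ·P p) i + coeff (c ·P q) i    ≡⟨ coeff-+P (c ·P p) (c ·P q) i ⟨
  coeff (c ·P p +P c ·P q) i             ∎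
  where open ≡-Reasoning

·P-assoc : ∀ a b p → (a * b) ·P p ≋ a ·P (b ·P p)
·P-assoc a b []      = ≋-refl
·P-assoc a b (c ∷ p) = ∷-cong (ℤ.*-assoc a b c) (·P-assoc a b p)

·P-identity : ∀ p → 1ℤ ·P p ≋ p
·P-identity []      = ≋-refl
·P-identity (a ∷ p) = ∷-cong (ℤ.*-identityˡ a) (·P-identity p)

·P-zero : ∀ p → 0ℤ ·P p ≋ []
·P-zero []      = ≋-refl
·P-zero (a ∷ p) = ≋-trans (∷-cong refl (·P-zero p)) 0∷[]≋[]

*P-zeroʳ : ∀ p → p *P [] ≋ []
*P-zeroʳ []      = ≋-refl
*P-zeroʳ (a ∷ p) = ≋-trans (∷-cong refl (*P-zeroʳ p)) 0∷[]≋[]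

*P-identityˡ : ∀ p → oneP *P p ≋ p
*P-identityˡ p = ≋-trans (+P-cong (·P-identity p) 0∷[]≋[]) (+P-identityʳ p)

*P-congʳ : ∀ p {q q'} → q ≋ q' → p *P q ≋ p *P q'
*P-congʳ []      e = ≋-refl
*P-congʳ (a ∷ p) e = +P-cong (·P-congʳ a e) (∷-cong refl (*P-congʳ p e))

*P-∷ʳ : ∀ p b q → p *P (b ∷ q) ≋ b ·P p +P (0ℤ ∷ p *P q)
*P-∷ʳ []      b q = ≋-sym 0∷[]≋[]
*P-∷ʳ (a ∷ p) b q = ∷-cong (cong (_+ 0ℤ) (ℤ.*-comm a b))
  (≋-trans (+P-cong ≋-refl (*P-∷ʳ p b q)) (x∙yz≈y∙xz (a ·P q) (b ·P p) _))

*P-comm : ∀ p q → p *P q ≋ q *P p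
*P-comm []      q = ≋-sym (*P-zeroʳ q)
*P-comm (a ∷ p) q = ≋-trans (+P-cong ≋-refl (∷-cong refl (*P-comm p q))) (≋-sym (*P-∷ʳ q a p))

*P-cong : ∀ {p p' q q'} → p ≋ p' → q ≋ q' → p *P q ≋ p' *P q'
*P-cong {p} {p'} {q} {q'} e f = begin
  p *P q   ≈⟨ *P-congʳ p f ⟩
  p *P q'  ≈⟨ *P-comm p q' ⟩
  q' *P p  ≈⟨ *P-congʳ q' e ⟩
  q' *P p' ≈⟨ *P-comm q' p' ⟩
  p' *P q' ∎
  where open ≋-Reasoning

*P-distribˡ : ∀ p q r → p *P (q +P r) ≋ p *P q +P p *P r
*P-distribˡ []      q r = ≋-refl
*P-distribˡ (a ∷ p) q r =
  ≋-trans (+P-cong (·P-distribˡ a q r) (∷-cong refl (*P-distribˡ p q r)))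
          (interchange (a ·P q) (a ·P r) (0ℤ ∷ p *P q) (0ℤ ∷ p *P r))

*P-distribʳ : ∀ r p q → (p +P q) *P r ≋ p *P r +P q *P r
*P-distribʳ r p q = begin
  (p +P q) *P r      ≈⟨ *P-comm (p +P q) r ⟩
  r *P (p +P q)      ≈⟨ *P-distribˡ r p q ⟩
  r *P p +P r *P q   ≈⟨ +P-cong (*P-comm r p) (*P-comm r q) ⟩
  p *P r +P q *P r   ∎
  where open ≋-Reasoning

0∷-*P : ∀ p q → (0ℤ ∷ p) *P q ≋ 0ℤ ∷ p *P q
0∷-*P p q = +P-cong (·P-zero q) ≋-refl

·P-*P : ∀ c p q → (c ·P p) *P q ≋ c ·P (p *P q)
·P-*P c []      q = ≋-refl
·P-*P c (a ∷ p) q = begin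
  (c * a) ·P q +P (0ℤ ∷ (c ·P p) *P q)    ≈⟨ +P-cong (·P-assoc c a q) (∷-cong refl (·P-*P c p q)) ⟩
  c ·P (a ·P q) +P (0ℤ ∷ c ·P (p *P q))   ≈⟨ +P-cong ≋-refl (∷-cong (sym (ℤ.*-zeroʳ c)) ≋-refl) ⟩
  c ·P (a ·P q) +P c ·P (0ℤ ∷ p *P q)     ≈⟨ ·P-distribˡ c (a ·P q) _ ⟨
  c ·P (a ·P q +P (0ℤ ∷ p *P q))          ∎
  where open ≋-Reasoning

*P-assoc : ∀ p q r → (p *P q) *P r ≋ p *P (q *P r)
*P-assoc []      q r = ≋-refl
*P-assoc (a ∷ p) q r = begin
  (a ·P q +P (0ℤ ∷ p *P q)) *P r          ≈⟨ *P-distribʳ r (a ·P q) _ ⟩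
  (a ·P q) *P r +P (0ℤ ∷ p *P q) *P r     ≈⟨ +P-cong (·P-*P a q r) (0∷-*P (p *P q) r) ⟩
  a ·P (q *P r) +P (0ℤ ∷ (p *P q) *P r)   ≈⟨ +P-cong ≋-refl (∷-cong refl (*P-assoc p q r)) ⟩
  a ·P (q *P r) +P (0ℤ ∷ p *P (q *P r))   ∎
  where open ≋-Reasoning

*P-identityʳ : ∀ p → p *P oneP ≋ p
*P-identityʳ p = ≋-trans (*P-comm p oneP) (*P-identityˡ p)

polyRing : CommutativeRing _ _
polyRing = record
  { isCommutativeRing = record
    { isRing = record
      { +-isAbelianGroup = +P-isAbelianGroup
      ; *-cong           = *P-cong
      ; *-assoc          = *P-assoc
      ; *-identity       = *P-identityˡ , *P-identityʳ
      ; distrib          = *P-distribˡ , *P-distribʳ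
      }
    ; *-comm = *P-comm
    }
  }

constP : ℤ → Poly
constP a = a ∷ []

constP-homomorphism : ℤ.+-*-rawRing -Raw-AlmostCommutative⟶ fromCommutativeRing polyRing
constP-homomorphism = record
  { ⟦_⟧    = constP
  ; +-homo = λ a b → ≋-refl
  ; *-homo = λ a b → ∷-cong (sym (ℤ.+-identityʳ _)) ≋-refl
  ; -‿homo = λ a → ∷-cong (sym (ℤ.-1*i≡-i a)) ≋-refl
  ; 0-homo = 0∷[]≋[]
  ; 1-homo = ≋-refl
  }

constP-≟ : ∀ a b → Maybe (constP a ≋ constP b)
constP-≟ a b with a ℤ.≟ b
... | yes refl = just ≋-refl
... | no _     = nothing

open import Algebra.Solver.Ring ℤ.+-*-rawRing (fromCommutativeRing polyRing) constP-homomorphism constP-≟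
  using (solve; _:+_; _:*_; :-_; _:-_; _:=_)

-- Factoring R = N T and S = D T

qPow-+ : ∀ a b → qPow a *P qPow b ≋ qPow (a ℕ.+ b)
qPow-+ zero    b = *P-identityˡ (qPow b)
qPow-+ (suc a) b = ≋-trans (0∷-*P (qPow a) (qPow b)) (∷-cong refl (qPow-+ a b))

record QPowInIdeal (N D : Poly) : Set where
  field
    A B      : Poly
    m        : ℕ
    identity : A *P N +P B *P D ≋ qPow m

qncf-qPowInIdeal : ∀ c cs → QPowInIdeal (proj₁ (qncf c cs)) (proj₂ (qncf c cs))
qncf-qPowInIdeal c []        = record { A = [] ; B = oneP ; m = 0 ; identity = *P-identityˡ oneP }
qncf-qPowInIdeal c (c′ ∷ cs) with qncf c′ cs | qncf-qPowInIdeal c′ cs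
... | N , D | record { A = A ; B = B ; m = m ; identity = AN+BD≋qᵐ } = record
  { A        = negP B
  ; B        = A *P Q +P B *P C
  ; m        = (c ℕ.∸ 1) ℕ.+ m
  ; identity = begin
      negP B *P (C *P N -P Q *P D) +P (A *P Q +P B *P C) *P N  ≈⟨ recombine C Q N D A B ⟩
      Q *P (A *P N +P B *P D)                                 ≈⟨ *P-congʳ Q AN+BD≋qᵐ ⟩
      Q *P qPow m                                             ≈⟨ qPow-+ (c ℕ.∸ 1) m ⟩
      qPow ((c ℕ.∸ 1) ℕ.+ m)                                  ∎
  }
  where
  open ≋-Reasoning
  C Q : Poly
  C = qInt c
  Q = qPow (c ℕ.∸ 1)
  recombine : ∀ C Q N D A B → negP B *P (C *P N -P Q *P D) +P (A *P Q +P B *P C) *P N ≋ Q *P (A *P N +P B *P D)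
  recombine = solve 6 (λ C Q N D A B → (:- B) :* (C :* N :- Q :* D) :+ (A :* Q :+ B :* C) :* N := Q :* (A :* N :+ B :* D)) ≋-refl

proportional⇒common-factor : ∀ {A B N D Q R S} → A *P N +P B *P D ≋ Q → R *P D ≋ S *P N →
               Q *P R ≋ N *P (A *P R +P B *P S) × Q *P S ≋ D *P (A *P R +P B *P S)
proportional⇒common-factor {A} {B} {N} {D} {Q} {R} {S} AN+BD≋Q RD≋SN =
  (begin
    Q *P R                        ≈⟨ *P-cong (≋-sym AN+BD≋Q) ≋-refl ⟩
    (A *P N +P B *P D) *P R       ≈⟨ expandR A B N D R ⟩
    N *P (A *P R) +P B *P (R *P D) ≈⟨ +P-cong ≋-refl (*P-congʳ B RD≋SN) ⟩
    N *P (A *P R) +P B *P (S *P N) ≈⟨ collectR A B N R S ⟩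
    N *P (A *P R +P B *P S)        ∎)
  ,
  (begin
    Q *P S                        ≈⟨ *P-cong (≋-sym AN+BD≋Q) ≋-refl ⟩
    (A *P N +P B *P D) *P S       ≈⟨ expandS A B N D S ⟩
    A *P (S *P N) +P D *P (B *P S) ≈⟨ +P-cong (*P-congʳ A (≋-sym RD≋SN)) ≋-refl ⟩
    A *P (R *P D) +P D *P (B *P S) ≈⟨ collectS A B D R S ⟩
    D *P (A *P R +P B *P S)        ∎)
  where
  open ≋-Reasoning
  expandR : ∀ A B N D R → (A *P N +P B *P D) *P R ≋ N *P (A *P R) +P B *P (R *P D)
  expandR = solve 5 (λ A B N D R → (A :* N :+ B :* D) :* R := N :* (A :* R) :+ B :* (R :* D)) ≋-refl
  collectR : ∀ A B N R S → N *P (A *P R) +P B *P (S *P N) ≋ N *P (A *P R +P B *P S)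
  collectR = solve 5 (λ A B N R S → N :* (A :* R) :+ B :* (S :* N) := N :* (A :* R :+ B :* S)) ≋-refl
  expandS : ∀ A B N D S → (A *P N +P B *P D) *P S ≋ A *P (S *P N) +P D *P (B *P S)
  expandS = solve 5 (λ A B N D S → (A :* N :+ B :* D) :* S := A :* (S :* N) :+ D :* (B :* S)) ≋-refl
  collectS : ∀ A B D R S → A *P (R *P D) +P D *P (B *P S) ≋ D *P (A *P R +P B *P S)
  collectS = solve 5 (λ A B D R S → A :* (R :* D) :+ D :* (B :* S) := D :* (A :* R :+ B :* S)) ≋-refl

coeff-*P-0 : ∀ p q → coeff (p *P q) 0 ≡ coeff p 0 * coeff q 0
coeff-*P-0 []      q = refl
coeff-*P-0 (a ∷ p) q = trans (coeff-+P (a ·P q) (0ℤ ∷ p *P q) 0)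
                             (trans (ℤ.+-identityʳ _) (coeff-·P a q 0))

tailP : Poly → Poly
tailP []      = []
tailP (_ ∷ p) = p

∷-injectiveʳ : ∀ {a b p q} → a ∷ p ≋ b ∷ q → p ≋ q
∷-injectiveʳ (mk≋ e) = mk≋ λ i → e (suc i)

*P-0∷ʳ : ∀ p q → p *P (0ℤ ∷ q) ≋ 0ℤ ∷ p *P q
*P-0∷ʳ p q = ≋-trans (*P-∷ʳ p 0ℤ q) (+P-cong (·P-zero p) ≋-refl)

≋0∷tailP : ∀ p → coeff p 0 ≡ 0ℤ → p ≋ 0ℤ ∷ tailP p
≋0∷tailP []      _  = ≋-sym 0∷[]≋[]
≋0∷tailP (a ∷ p) a≡0 = ∷-cong a≡0 ≋-refl

coeff-0-cancelˡ : ∀ {N T} → coeff N 0 ≡ 1ℤ → coeff (N *P T) 0 ≡ 0ℤ → coeff T 0 ≡ 0ℤ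
coeff-0-cancelˡ {N} {T} N₀≡1 NT₀≡0 = begin
  coeff T 0              ≡⟨ ℤ.*-identityˡ (coeff T 0) ⟨
  1ℤ * coeff T 0         ≡⟨ cong (_* coeff T 0) N₀≡1 ⟨
  coeff N 0 * coeff T 0  ≡⟨ coeff-*P-0 N T ⟨
  coeff (N *P T) 0       ≡⟨ NT₀≡0 ⟩
  0ℤ                     ∎
  where open ≡-Reasoning

qPow-cancel : ∀ m N D {R S T} → coeff N 0 ≡ 1ℤ → qPow m *P R ≋ N *P T → qPow m *P S ≋ D *P T →
              Σ Poly λ T′ → N *P T′ ≋ R × D *P T′ ≋ S
qPow-cancel zero    N D {T = T} _ R≋NT S≋DT =
  T , ≋-trans (≋-sym R≋NT) (*P-identityˡ _) , ≋-trans (≋-sym S≋DT) (*P-identityˡ _)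
qPow-cancel (suc m) N D {R} {S} {T} N₀≡1 qR≋NT qS≋DT =
  qPow-cancel m N D N₀≡1 (divide-by-q N qR≋NT) (divide-by-q D qS≋DT)
  where
  NT₀≡0 : coeff (N *P T) 0 ≡ 0ℤ
  NT₀≡0 = trans (sym (coeff-≡ qR≋NT 0)) (coeff-*P-0 (qPow (suc m)) R)
  T≋0∷T′ : T ≋ 0ℤ ∷ tailP T
  T≋0∷T′ = ≋0∷tailP T (coeff-0-cancelˡ {N} {T} N₀≡1 NT₀≡0)
  divide-by-q : ∀ M {X} → qPow (suc m) *P X ≋ M *P T → qPow m *P X ≋ M *P tailP T
  divide-by-q M {X} h = ∷-injectiveʳ (begin
    0ℤ ∷ qPow m *P X        ≈⟨ 0∷-*P (qPow m) X ⟨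
    qPow (suc m) *P X       ≈⟨ h ⟩
    M *P T                  ≈⟨ *P-congʳ M T≋0∷T′ ⟩
    M *P (0ℤ ∷ tailP T)     ≈⟨ *P-0∷ʳ M (tailP T) ⟩
    0ℤ ∷ M *P tailP T       ∎)
    where open ≋-Reasoning

qncf-coeff-0 : ∀ c cs → All (2 ≤_) (c ∷ cs) → coeff (proj₁ (qncf c cs)) 0 ≡ 1ℤ
qncf-coeff-0 zero          _         (() ∷ _)
qncf-coeff-0 (suc zero)    _         (s≤s () ∷ _)
qncf-coeff-0 (suc (suc k)) []        _              = refl
qncf-coeff-0 (suc (suc k)) (c′ ∷ cs) (_ ∷ c′cs≥2) with qncf c′ cs | qncf-coeff-0 c′ cs c′cs≥2
... | N , D | N₀≡1 = begin
  coeff (C *P N -P Q *P D) 0                      ≡⟨ coeff-+P (C *P N) (negP (Q *P D)) 0 ⟩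
  coeff (C *P N) 0 + coeff (negP (Q *P D)) 0      ≡⟨ cong₂ _+_ (coeff-*P-0 C N) (coeff-·P (- 1ℤ) (Q *P D) 0) ⟩
  1ℤ * coeff N 0 + - 1ℤ * coeff (Q *P D) 0        ≡⟨ cong₂ (λ u v → 1ℤ * u + - 1ℤ * v) N₀≡1 (coeff-*P-0 Q D) ⟩
  1ℤ                                              ∎
  where
  open ≡-Reasoning
  C = qInt (suc (suc k))
  Q = qPow (suc k)

qncf-divides : ∀ c cs → All (2 ≤_) (c ∷ cs) → ∀ {R S} →
               R *P proj₂ (qncf c cs) ≋ S *P proj₁ (qncf c cs) →
               Σ Poly λ T → proj₁ (qncf c cs) *P T ≋ R × proj₂ (qncf c cs) *P T ≋ S
qncf-divides c cs ccs≥2 {R} {S} RD≋SN =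
  qPow-cancel m (proj₁ (qncf c cs)) (proj₂ (qncf c cs)) (qncf-coeff-0 c cs ccs≥2) (proj₁ factors) (proj₂ factors)
  where
  open QPowInIdeal (qncf-qPowInIdeal c cs)
  factors = proportional⇒common-factor {A} {B} identity RD≋SN

evalP-+P : ∀ p q x → evalP (p +P q) x ≡ evalP p x + evalP q x
evalP-+P []      q       x = sym (ℤ.+-identityˡ _)
evalP-+P (a ∷ p) []      x = sym (ℤ.+-identityʳ _)
evalP-+P (a ∷ p) (b ∷ q) x = trans (cong (λ v → a + b + x * v) (evalP-+P p q x)) (rearrange a b x _ _)
  where
  rearrange : ∀ a b x u v → a + b + x * (u + v) ≡ a + x * u + (b + x * v)
  rearrange = solve-∀

evalP-·P : ∀ c p x → evalP (c ·P p) x ≡ c * evalP p x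
evalP-·P c []      x = sym (ℤ.*-zeroʳ c)
evalP-·P c (a ∷ p) x = trans (cong (λ v → c * a + x * v) (evalP-·P c p x)) (rearrange c a x _)
  where
  rearrange : ∀ c a x u → c * a + x * (c * u) ≡ c * (a + x * u)
  rearrange = solve-∀

evalP-*P : ∀ p q x → evalP (p *P q) x ≡ evalP p x * evalP q x
evalP-*P []      q x = refl
evalP-*P (a ∷ p) q x = begin
  evalP (a ·P q +P (0ℤ ∷ p *P q)) x                 ≡⟨ evalP-+P (a ·P q) _ x ⟩
  evalP (a ·P q) x + (0ℤ + x * evalP (p *P q) x)    ≡⟨ cong₂ (λ u v → u + (0ℤ + x * v)) (evalP-·P a q x) (evalP-*P p q x) ⟩
  a * evalP q x + (0ℤ + x * (evalP p x * evalP q x)) ≡⟨ rearrange a x (evalP p x) (evalP q x) ⟩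
  (a + x * evalP p x) * evalP q x                   ∎
  where
  open ≡-Reasoning
  rearrange : ∀ a x u v → a * v + (0ℤ + x * (u * v)) ≡ (a + x * u) * v
  rearrange = solve-∀

evalP-≋[] : ∀ {p} x → p ≋ [] → evalP p x ≡ 0ℤ
evalP-≋[] {[]}    x _       = refl
evalP-≋[] {a ∷ p} x (mk≋ e) =
  trans (cong₂ (λ u v → u + x * v) (e 0) (evalP-≋[] {p} x (mk≋ λ i → e (suc i)))) (trans (ℤ.+-identityˡ _) (ℤ.*-zeroʳ x))

evalP-cong : ∀ {p q} x → p ≋ q → evalP p x ≡ evalP q x
evalP-cong {[]}    {q}     x e       = sym (evalP-≋[] x (≋-sym e))
evalP-cong {a ∷ p} {[]}    x e       = evalP-≋[] x e
evalP-cong {a ∷ p} {b ∷ q} x (mk≋ e) = cong₂ (λ u v → u + x * v) (e 0) (evalP-cong {p} {q} x (mk≋ λ i → e (suc i)))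

evalP-±1-congruent : ∀ p → Σ ℤ λ k → evalP p 1ℤ ≡ evalP p (- 1ℤ) + + 2 * k
evalP-±1-congruent []      = 0ℤ , refl
evalP-±1-congruent (a ∷ p) with evalP-±1-congruent p
... | k , p₁≡p₋₁+2k = evalP p (- 1ℤ) + k , trans (cong (λ v → a + 1ℤ * v) p₁≡p₋₁+2k) (rearrange a _ k)
  where
  rearrange : ∀ a u k → a + 1ℤ * (u + + 2 * k) ≡ a + - 1ℤ * u + + 2 * (u + k)
  rearrange = solve-∀

Trit : ℤ → Set
Trit x = x ≡ - 1ℤ ⊎ x ≡ 0ℤ ⊎ x ≡ 1ℤ

IsUnit : ℤ → Set
IsUnit x = x ≡ 1ℤ ⊎ x ≡ - 1ℤ

∣i∣≡1⇒isUnit : ∀ i → ∣ i ∣ ≡ 1 → IsUnit i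
∣i∣≡1⇒isUnit (+ 1)      refl = inj₁ refl
∣i∣≡1⇒isUnit -[1+ 0 ]   refl = inj₂ refl
∣i∣≡1⇒isUnit (+ 0)      ()
∣i∣≡1⇒isUnit (+ suc (suc n)) ()
∣i∣≡1⇒isUnit -[1+ suc n ] ()

i*j≡1⇒isUnit : ∀ i j → i * j ≡ 1ℤ → IsUnit i
i*j≡1⇒isUnit i j i*j≡1 =
  ∣i∣≡1⇒isUnit i (ℕ.m*n≡1⇒m≡1 ∣ i ∣ ∣ j ∣ (trans (sym (ℤ.abs-* i j)) (cong ∣_∣ i*j≡1)))

trit-*-unit : ∀ {i u} → Trit i → IsUnit u → Trit (i * u)
trit-*-unit (inj₁ refl)        (inj₁ refl) = inj₁ refl
trit-*-unit (inj₁ refl)        (inj₂ refl) = inj₂ (inj₂ refl)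
trit-*-unit (inj₂ (inj₁ refl)) (inj₁ refl) = inj₂ (inj₁ refl)
trit-*-unit (inj₂ (inj₁ refl)) (inj₂ refl) = inj₂ (inj₁ refl)
trit-*-unit (inj₂ (inj₂ refl)) (inj₁ refl) = inj₂ (inj₂ refl)
trit-*-unit (inj₂ (inj₂ refl)) (inj₂ refl) = inj₁ refl

2*i≢±1 : ∀ i → ∣ + 2 * i ∣ ≢ 1
2*i≢±1 i ∣2i∣≡1 with ℕ.m*n≡1⇒m≡1 2 ∣ i ∣ (trans (sym (ℤ.abs-* (+ 2) i)) ∣2i∣≡1)
... | ()

even-trit≡0 : ∀ {x} i → Trit x → x ≡ + 2 * i → x ≡ 0ℤ
even-trit≡0 i (inj₁ refl)        x≡2i = contradiction (cong ∣_∣ (sym x≡2i)) (2*i≢±1 i)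
even-trit≡0 i (inj₂ (inj₁ x≡0))  _    = x≡0
even-trit≡0 i (inj₂ (inj₂ refl)) x≡2i = contradiction (cong ∣_∣ (sym x≡2i)) (2*i≢±1 i)

trit-≡0⇔even : ∀ {x n} → Trit x → (Σ ℤ λ k → + n ≡ x + + 2 * k) → (x ≡ 0ℤ ⇔ 2 ∣ n)
trit-≡0⇔even {x} {n} x-trit (k , n≡x+2k) = mk⇔ even fromEven
  where
  even : x ≡ 0ℤ → 2 ∣ n
  even refl = divides ∣ k ∣ (begin
    n                 ≡⟨ cong ∣_∣ n≡x+2k ⟩
    ∣ 0ℤ + + 2 * k ∣  ≡⟨ cong ∣_∣ (ℤ.+-identityˡ (+ 2 * k)) ⟩
    ∣ + 2 * k ∣       ≡⟨ ℤ.abs-* (+ 2) k ⟩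
    2 ℕ.* ∣ k ∣       ≡⟨ ℕ.*-comm 2 ∣ k ∣ ⟩
    ∣ k ∣ ℕ.* 2       ∎)
    where open ≡-Reasoning
  x≡2[j-k] : ∀ j → n ≡ j ℕ.* 2 → x ≡ + 2 * (+ j - k)
  x≡2[j-k] j refl = begin
    x                       ≡⟨ rearrange x k ⟨
    x + + 2 * k - + 2 * k   ≡⟨ cong (_- + 2 * k) n≡x+2k ⟨
    + (j ℕ.* 2) - + 2 * k   ≡⟨ cong (_- + 2 * k) (ℤ.pos-* j 2) ⟩
    + j * + 2 - + 2 * k     ≡⟨ distribute (+ j) k ⟩
    + 2 * (+ j - k)         ∎
    where
    open ≡-Reasoning
    rearrange : ∀ x k → x + + 2 * k - + 2 * k ≡ x
    rearrange = solve-∀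
    distribute : ∀ j k → j * + 2 - + 2 * k ≡ + 2 * (j - k)
    distribute = solve-∀
  fromEven : 2 ∣ n → x ≡ 0ℤ
  fromEven (divides j n≡2j) = even-trit≡0 (+ j - k) x-trit (x≡2[j-k] j n≡2j)

-- The continued fraction at q = -1

evalP-[-1]-∷∷ : ∀ a p → evalP (a ∷ a ∷ p) (- 1ℤ) ≡ evalP p (- 1ℤ)
evalP-[-1]-∷∷ a p = cancel a (evalP p (- 1ℤ))
  where
  cancel : ∀ a u → a + - 1ℤ * (a + - 1ℤ * u) ≡ u
  cancel = solve-∀

-- The pair ([c]_q , q^(c-1)) at q = -1, according to the parity of c.
data ParityAt[-1] : ℤ → ℤ → Set where
  even : ParityAt[-1] 0ℤ (- 1ℤ)
  odd  : ParityAt[-1] 1ℤ 1ℤ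

qInt-qPow-at-[-1] : ∀ k → ParityAt[-1] (evalP (qInt (suc k)) (- 1ℤ)) (evalP (qPow k) (- 1ℤ))
qInt-qPow-at-[-1] zero          = odd
qInt-qPow-at-[-1] (suc zero)    = even
qInt-qPow-at-[-1] (suc (suc k))
  rewrite evalP-[-1]-∷∷ 1ℤ (qInt (suc k)) | evalP-[-1]-∷∷ 0ℤ (qPow k) = qInt-qPow-at-[-1] k

data Hexagon : ℤ → ℤ → Set where
  e₁  : Hexagon 1ℤ 0ℤ
  e₂  : Hexagon 0ℤ 1ℤ
  e₁₂ : Hexagon 1ℤ 1ℤ
  -e₁  : Hexagon (- 1ℤ) 0ℤ
  -e₂  : Hexagon 0ℤ (- 1ℤ)
  -e₁₂ : Hexagon (- 1ℤ) (- 1ℤ)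

hexagon-trits : ∀ {a b} → Hexagon a b → Trit a × Trit b
hexagon-trits e₁   = inj₂ (inj₂ refl) , inj₂ (inj₁ refl)
hexagon-trits e₂   = inj₂ (inj₁ refl) , inj₂ (inj₂ refl)
hexagon-trits e₁₂  = inj₂ (inj₂ refl) , inj₂ (inj₂ refl)
hexagon-trits -e₁  = inj₁ refl        , inj₂ (inj₁ refl)
hexagon-trits -e₂  = inj₂ (inj₁ refl) , inj₁ refl
hexagon-trits -e₁₂ = inj₁ refl        , inj₁ refl

hexagon-base : ∀ {i w} → ParityAt[-1] i w → Hexagon i 1ℤ
hexagon-base even = e₂
hexagon-base odd  = e₁₂

-- At q = -1 a step of the recursion maps (N, D) to (D, N) for even c and to (N - D, N) for odd c.
hexagon-step : ∀ {i w a b} → ParityAt[-1] i w → Hexagon a b → Hexagon (i * a + - 1ℤ * (w * b)) a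
hexagon-step even e₁   = e₂
hexagon-step even e₂   = e₁
hexagon-step even e₁₂  = e₁₂
hexagon-step even -e₁  = -e₂
hexagon-step even -e₂  = -e₁
hexagon-step even -e₁₂ = -e₁₂
hexagon-step odd  e₁   = e₁₂
hexagon-step odd  e₂   = -e₁
hexagon-step odd  e₁₂  = e₂
hexagon-step odd  -e₁  = -e₁₂
hexagon-step odd  -e₂  = e₁
hexagon-step odd  -e₁₂ = -e₂

evalP-qncf-step : ∀ c N D x → evalP (qInt c *P N -P qPow (c ℕ.∸ 1) *P D) x
                  ≡ evalP (qInt c) x * evalP N x + - 1ℤ * (evalP (qPow (c ℕ.∸ 1)) x * evalP D x)
evalP-qncf-step c N D x = begin
  evalP (qInt c *P N -P Q *P D) x                    ≡⟨ evalP-+P (qInt c *P N) _ x ⟩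
  evalP (qInt c *P N) x + evalP (negP (Q *P D)) x    ≡⟨ cong₂ _+_ (evalP-*P (qInt c) N x) (evalP-·P (- 1ℤ) (Q *P D) x) ⟩
  evalP (qInt c) x * evalP N x + - 1ℤ * evalP (Q *P D) x ≡⟨ cong (λ v → evalP (qInt c) x * evalP N x + - 1ℤ * v) (evalP-*P Q D x) ⟩
  evalP (qInt c) x * evalP N x + - 1ℤ * (evalP Q x * evalP D x) ∎
  where
  open ≡-Reasoning
  Q = qPow (c ℕ.∸ 1)

qncf-at-[-1] : ∀ c cs → All (1 ≤_) (c ∷ cs) →
               Hexagon (evalP (proj₁ (qncf c cs)) (- 1ℤ)) (evalP (proj₂ (qncf c cs)) (- 1ℤ))
qncf-at-[-1] zero    _         (() ∷ _)
qncf-at-[-1] (suc k) []        _                 = hexagon-base (qInt-qPow-at-[-1] k)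
qncf-at-[-1] (suc k) (c′ ∷ cs) (_ ∷ c′cs≥1) with qncf c′ cs | qncf-at-[-1] c′ cs c′cs≥1
... | N , D | hexND rewrite evalP-qncf-step (suc k) N D (- 1ℤ) = hexagon-step (qInt-qPow-at-[-1] k) hexND

factorʳ-∣P : ∀ {N T R} → N *P T ≋ R → T ∣P R
factorʳ-∣P {N} {T} NT≋R = N , coeff-≡ (≋-trans (*P-comm T N) NT≋R)

∣P-oneP⇒isUnit : ∀ d x → d ∣P oneP → IsUnit (evalP d x)
∣P-oneP⇒isUnit d x (e , de≈1) = i*j≡1⇒isUnit (evalP d x) (evalP e x) (begin
  evalP d x * evalP e x  ≡⟨ evalP-*P d e x ⟨
  evalP (d *P e) x       ≡⟨ evalP-cong {d *P e} x (mk≋ de≈1) ⟩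
  1ℤ + x * 0ℤ            ≡⟨ cong (_+_ 1ℤ) (ℤ.*-zeroʳ x) ⟩
  1ℤ                     ∎)
  where open ≡-Reasoning

trit-*P-unit : ∀ {M T P} x → M *P T ≋ P → Trit (evalP M x) → IsUnit (evalP T x) → Trit (evalP P x)
trit-*P-unit {M} {T} x MT≋P M-trit T-unit =
  subst Trit (trans (sym (evalP-*P M T x)) (evalP-cong x MT≋P)) (trit-*-unit M-trit T-unit)

qncf-trits : ∀ c cs → All (2 ≤_) (c ∷ cs) → ∀ R S → CoprimeP R S →
             R *P proj₂ (qncf c cs) ≋ S *P proj₁ (qncf c cs) →
             Trit (evalP R (- 1ℤ)) × Trit (evalP S (- 1ℤ))
qncf-trits c cs ccs≥2 R S R⊥S RD≋SN =
  trit-*P-unit {N} {T} (- 1ℤ) NT≋R (proj₁ ND-trits) T-unit ,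
  trit-*P-unit {D} {T} (- 1ℤ) DT≋S (proj₂ ND-trits) T-unit
  where
  N D : Poly
  N = proj₁ (qncf c cs)
  D = proj₂ (qncf c cs)
  factorisation : Σ Poly λ T → N *P T ≋ R × D *P T ≋ S
  factorisation = qncf-divides c cs ccs≥2 RD≋SN
  T : Poly
  T = proj₁ factorisation
  NT≋R : N *P T ≋ R
  NT≋R = proj₁ (proj₂ factorisation)
  DT≋S : D *P T ≋ S
  DT≋S = proj₂ (proj₂ factorisation)
  T-unit : IsUnit (evalP T (- 1ℤ))
  T-unit = ∣P-oneP⇒isUnit T (- 1ℤ) (R⊥S T (factorʳ-∣P {N} NT≋R) (factorʳ-∣P {D} DT≋S))
  ND-trits : Trit (evalP N (- 1ℤ)) × Trit (evalP D (- 1ℤ))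
  ND-trits = hexagon-trits (qncf-at-[-1] c cs (All.map ℕ.<⇒≤ ccs≥2))

proposition1p10 :
    (r s : ℕ) → 1 ≤ s → s < r → Coprime r s →
    (c : ℕ) (cs : List ℕ) → All (2 ≤_) (c ∷ cs) →
    (+ r) ℤ.* proj₂ (ncf c cs) ≡ (+ s) ℤ.* proj₁ (ncf c cs) →
    (R S : Poly) → CoprimeP R S → evalP R 1ℤ ≡ + r → evalP S 1ℤ ≡ + s →
    R *P proj₂ (qncf c cs) ≈P S *P proj₁ (qncf c cs) →
    ((evalP R (- 1ℤ) ≡ - 1ℤ ⊎ evalP R (- 1ℤ) ≡ 0ℤ ⊎ evalP R (- 1ℤ) ≡ 1ℤ)
     × (evalP S (- 1ℤ) ≡ - 1ℤ ⊎ evalP S (- 1ℤ) ≡ 0ℤ ⊎ evalP S (- 1ℤ) ≡ 1ℤ))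
    × (evalP R (- 1ℤ) ≡ 0ℤ ⇔ 2 ∣ r)
    × (evalP S (- 1ℤ) ≡ 0ℤ ⇔ 2 ∣ s)
proposition1p10 r s _ _ _ c cs ccs≥2 _ R S R⊥S R₁≡r S₁≡s RD≈SN =
  trits , trit-≡0⇔even (proj₁ trits) (parity R R₁≡r) , trit-≡0⇔even (proj₂ trits) (parity S S₁≡s)
  where
  trits : Trit (evalP R (- 1ℤ)) × Trit (evalP S (- 1ℤ))
  trits = qncf-trits c cs ccs≥2 R S R⊥S (mk≋ RD≈SN)
  parity : ∀ P {n} → evalP P 1ℤ ≡ + n → Σ ℤ λ k → + n ≡ evalP P (- 1ℤ) + + 2 * k
  parity P P₁≡n = proj₁ (evalP-±1-congruent P) , trans (sym P₁≡n) (proj₂ (evalP-±1-congruent P))
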